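{- Let $G$ be a cograph. If $G$ has an isolated vertex then $B(G)=1$; otherwise $B(G)=2$.
   Context: Cographs are defined recursively: a graph with a single vertex is a cograph; if $G_1,G_2$ are cographs then so are their disjoint union $G_1\cup G_2$ and their join $G_1+G_2$ (the disjoint union together with all edges between $V(G_1)$ and $V(G_2)$). In a graph each vertex is black or white; in the zero forcing process, if a black vertex has exactly one white neighbor $w$, then $w$ becomes black, iterated. A set $S$ of initially black vertices is a failed zero forcing set if the process does not make all vertices black, and then $V(G)\setminus S$ is a zero blocking set. $B(G)$ is the minimum size of a zero blocking set of $G$. A vertex is isolated if it has no neighbors. -}

module Defs where

open import Data.Nat using (ℕ; zero; suc; _+_; _≤_)
open import Data.Bool using (Bool; true; false)
open import Data.Fin using (Fin; splitAt)
open import Data.Fin.Subset using (Subset; _∈_; ∁; ∣_∣)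
open import Data.Sum using (_⊎_; inj₁; inj₂)
open import Data.Product using (Σ; ∃; _×_; _,_)
open import Relation.Nullary using (¬_)
open import Relation.Binary.PropositionalEquality using (_≡_; _≢_)
open import Function.Bundles using (Bijection; _⤖_)

Graph : ℕ → Set
Graph n = Fin n → Fin n → Bool

Adj : ∀ {n} → Graph n → Fin n → Fin n → Set
Adj G u v = G u v ≡ true

single : Graph 1
single _ _ = false

combine : ∀ {m n} → Bool → (Fin m → Fin m → Bool) → (Fin n → Fin n → Bool)
        → (Fin m ⊎ Fin n) → (Fin m ⊎ Fin n) → Bool
combine c G H (inj₁ a) (inj₁ b) = G a b
combine c G H (inj₂ a) (inj₂ b) = H a b
combine c G H (inj₁ _) (inj₂ _) = c
combine c G H (inj₂ _) (inj₁ _) = c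

disjointUnion : ∀ {m n} → Graph m → Graph n → Graph (m + n)
disjointUnion {m} G H u v = combine false G H (splitAt m u) (splitAt m v)

graphJoin : ∀ {m n} → Graph m → Graph n → Graph (m + n)
graphJoin {m} G H u v = combine true G H (splitAt m u) (splitAt m v)

Iso : ∀ {m n} → Graph m → Graph n → Set
Iso {m} {n} G H =
  Σ (Fin m ⤖ Fin n) λ f →
    ∀ u v → H (Bijection.to f u) (Bijection.to f v) ≡ G u v

data IsCograph : ∀ {n} → Graph n → Set where
  cg-single : IsCograph single
  cg-union  : ∀ {m n} {G : Graph m} {H : Graph n} →
              IsCograph G → IsCograph H → IsCograph (disjointUnion G H)
  cg-join   : ∀ {m n} {G : Graph m} {H : Graph n} →
              IsCograph G → IsCograph H → IsCograph (graphJoin G H)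
  cg-iso    : ∀ {m n} {G : Graph m} {H : Graph n} →
              Iso G H → IsCograph G → IsCograph H

-- Zero forcing: the set of vertices eventually black when S is initially black.
-- Rule: a black vertex u all of whose neighbours other than w are black forces
-- its (unique white) neighbour w.
data Black {n} (G : Graph n) (S : Subset n) : Fin n → Set where
  initial : ∀ {v} → v ∈ S → Black G S v
  force   : ∀ {u w} → Black G S u → Adj G u w →
            (∀ x → Adj G u x → x ≢ w → Black G S x) → Black G S w

FailedZF : ∀ {n} → Graph n → Subset n → Set
FailedZF G S = ¬ (∀ v → Black G S v)

ZeroBlocking : ∀ {n} → Graph n → Subset n → Set
ZeroBlocking G T = FailedZF G (∁ T)

BIs : ∀ {n} → Graph n → ℕ → Set
BIs {n} G k =
  (∃ λ (T : Subset n) → ZeroBlocking G T × ∣ T ∣ ≡ k) ×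
  (∀ (T : Subset n) → ZeroBlocking G T → k ≤ ∣ T ∣)

Isolated : ∀ {n} → Graph n → Fin n → Set
Isolated G v = ∀ u → ¬ Adj G v u

{-# OPTIONS --safe #-}

-- A nonempty fort T (every vertex outside T with a neighbour in T has at least
-- two of them) is a zero blocking set: no vertex outside T can ever force a
-- vertex of T. An isolated vertex is a fort on its own, and so is a pair of
-- twins, i.e. two vertices with the same neighbours outside the pair. Every
-- cograph on at least two vertices has twins, because disjoint union and join
-- keep the twins of either side and make twins of two single vertices.
-- Conversely the empty set never blocks, and without isolated vertices neither
-- does a single vertex w: any neighbour of w forces it.
module Submission where

open import Defs
open import Data.Nat using (ℕ; _≤_; _<_; _≤?_)
import Data.Nat as Nat
open import Data.Fin using (Fin; zero; suc; splitAt; _≟_)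
open import Data.Fin.Properties using (+↔⊎; splitAt-join; any?)
open import Data.Fin.Subset using (Subset; _∈_; _∉_; _⊆_; ∁; ∣_∣; ⁅_⁆; _∪_; Nonempty)
open import Data.Fin.Subset.Properties
  using ( x∈⁅x⁆; x∈⁅y⁆⇒x≡y; x≢y⇒x∉⁅y⁆; ∣⁅x⁆∣≡1; ∪-identityˡ; ∪-identityʳ; x∈p∪q⁺; x∈p∪q⁻
        ; p⊆q⇒∣p∣≤∣q∣; p⊂q⇒∣p∣<∣q∣; x∈∁p⇒x∉p; x∉p⇒x∈∁p; nonempty? )
open import Data.Bool using (Bool; true; false)
import Data.Bool.Properties as Bool
open import Data.Sum using (_⊎_; inj₁; inj₂; [_,_]′)
open import Data.Sum.Properties using (inj₁-injective; inj₂-injective)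
open import Data.Product using (Σ; ∃; ∃₂; _×_; _,_; proj₁; proj₂)
open import Data.Empty using (⊥-elim)
open import Function using (_∘_)
open import Function.Bundles using (Bijection; Inverse; _⤖_)
open import Function.Properties.Bijection using (⤖⇒↔)
open import Function.Properties.Inverse using (↔⇒⤖; ↔-sym)
open import Relation.Nullary using (¬_; yes; no)
open import Relation.Nullary.Decidable using (decidable-stable)
open import Relation.Binary.PropositionalEquality

GraphOn : Set → Set
GraphOn V = V → V → Bool

_≅_ : ∀ {A B : Set} → GraphOn A → GraphOn B → Set
_≅_ {A} {B} G H = Σ (A ⤖ B) λ f → ∀ u v → H (Bijection.to f u) (Bijection.to f v) ≡ G u v

Loopless : ∀ {V : Set} → GraphOn V → Set
Loopless G = ∀ x → G x x ≡ false

Undirected : ∀ {V : Set} → GraphOn V → Set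
Undirected G = ∀ x y → G x y ≡ G y x

Twins : ∀ {V : Set} → GraphOn V → V → V → Set
Twins G u v = u ≢ v × (∀ x → x ≢ u → x ≢ v → G x u ≡ G x v)

IsSingleton : Set → Set
IsSingleton V = Σ V λ a → ∀ x → x ≡ a

SingletonOrTwins : ∀ {V : Set} → GraphOn V → Set
SingletonOrTwins {V} G = IsSingleton V ⊎ ∃₂ (Twins G)

module ≅-Transport {A B : Set} (G : GraphOn A) (H : GraphOn B) (G≅H : G ≅ H) where
  open Inverse (⤖⇒↔ (proj₁ G≅H)) using (to; from; strictlyInverseˡ; strictlyInverseʳ)
  open Bijection (proj₁ G≅H) using (injective)

  H≡G∘from : ∀ x y → H x y ≡ G (from x) (from y)
  H≡G∘from x y = begin
    H x y                         ≡⟨ cong₂ H (strictlyInverseˡ x) (strictlyInverseˡ y) ⟨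
    H (to (from x)) (to (from y)) ≡⟨ proj₂ G≅H (from x) (from y) ⟩
    G (from x) (from y)           ∎
    where open ≡-Reasoning

  H-to : ∀ x a → H x (to a) ≡ G (from x) a
  H-to x a = trans (H≡G∘from x (to a)) (cong (G (from x)) (strictlyInverseʳ a))

  from-avoids : ∀ {x a} → x ≢ to a → from x ≢ a
  from-avoids {x} x≢to-a from-x≡a = x≢to-a (trans (sym (strictlyInverseˡ x)) (cong to from-x≡a))

  loopless : Loopless G → Loopless H
  loopless G-loopless x = trans (H≡G∘from x x) (G-loopless (from x))

  undirected : Undirected G → Undirected H
  undirected G-undirected x y =
    trans (H≡G∘from x y) (trans (G-undirected (from x) (from y)) (sym (H≡G∘from y x)))

  twins : ∀ {u v} → Twins G u v → Twins H (to u) (to v)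
  twins {u} {v} (u≢v , same) = u≢v ∘ injective , λ x x≢u x≢v →
    trans (H-to x u) (trans (same (from x) (from-avoids x≢u) (from-avoids x≢v)) (sym (H-to x v)))

  singletonOrTwins : SingletonOrTwins G → SingletonOrTwins H
  singletonOrTwins (inj₁ (a , only-a)) =
    inj₁ (to a , λ x → trans (sym (strictlyInverseˡ x)) (cong to (only-a (from x))))
  singletonOrTwins (inj₂ (u , v , uv-twins)) = inj₂ (to u , to v , twins uv-twins)

module _ {m n} (c : Bool) (G : Graph m) (H : Graph n) where

  combine-loopless : Loopless G → Loopless H → Loopless (combine c G H)
  combine-loopless G-loopless H-loopless (inj₁ x) = G-loopless x
  combine-loopless G-loopless H-loopless (inj₂ y) = H-loopless y

  combine-undirected : Undirected G → Undirected H → Undirected (combine c G H)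
  combine-undirected G-undirected H-undirected (inj₁ x) (inj₁ y) = G-undirected x y
  combine-undirected G-undirected H-undirected (inj₁ x) (inj₂ y) = refl
  combine-undirected G-undirected H-undirected (inj₂ x) (inj₁ y) = refl
  combine-undirected G-undirected H-undirected (inj₂ x) (inj₂ y) = H-undirected x y

  inj₁-twins : ∀ {u v} → Twins G u v → Twins (combine c G H) (inj₁ u) (inj₁ v)
  inj₁-twins (u≢v , same) = u≢v ∘ inj₁-injective , λ
    { (inj₁ x) x≢u x≢v → same x (x≢u ∘ cong inj₁) (x≢v ∘ cong inj₁)
    ; (inj₂ y) _   _   → refl
    }

  inj₂-twins : ∀ {u v} → Twins H u v → Twins (combine c G H) (inj₂ u) (inj₂ v)
  inj₂-twins (u≢v , same) = u≢v ∘ inj₂-injective , λ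
    { (inj₁ x) _   _   → refl
    ; (inj₂ y) y≢u y≢v → same y (y≢u ∘ cong inj₂) (y≢v ∘ cong inj₂)
    }

  singletons-twins : ((a , only-a) : IsSingleton (Fin m)) ((b , only-b) : IsSingleton (Fin n)) →
                     Twins (combine c G H) (inj₁ a) (inj₂ b)
  singletons-twins (a , only-a) (b , only-b) = (λ ()) , λ
    { (inj₁ x) x≢a _   → ⊥-elim (x≢a (cong inj₁ (only-a x)))
    ; (inj₂ y) _   y≢b → ⊥-elim (y≢b (cong inj₂ (only-b y)))
    }

  combine-singletonOrTwins : SingletonOrTwins G → SingletonOrTwins H →
                             SingletonOrTwins (combine c G H)
  combine-singletonOrTwins (inj₂ (u , v , t)) _ = inj₂ (inj₁ u , inj₁ v , inj₁-twins t)
  combine-singletonOrTwins (inj₁ _) (inj₂ (u , v , t)) = inj₂ (inj₂ u , inj₂ v , inj₂-twins t)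
  combine-singletonOrTwins (inj₁ a) (inj₁ b) = inj₂ (inj₁ _ , inj₂ _ , singletons-twins a b)

  -- The right-hand side is disjointUnion G H for c = false and graphJoin G H for c = true.
  combine≅ : combine c G H ≅ (λ u v → combine c G H (splitAt m u) (splitAt m v))
  combine≅ = ↔⇒⤖ (↔-sym +↔⊎) , λ a b →
    cong₂ (combine c G H) (splitAt-join m n a) (splitAt-join m n b)

module _ (P : ∀ {V : Set} → GraphOn V → Set)
         (P-single : P single)
         (P-combine : ∀ {m n} c (G : Graph m) (H : Graph n) → P G → P H → P (combine c G H))
         (P-≅ : ∀ {A B : Set} (G : GraphOn A) (H : GraphOn B) → G ≅ H → P G → P H)
         where

  cograph-induction : ∀ {n} {G : Graph n} → IsCograph G → P G
  cograph-induction cg-single = P-single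
  cograph-induction (cg-union g h) =
    P-≅ _ _ (combine≅ false _ _) (P-combine false _ _ (cograph-induction g) (cograph-induction h))
  cograph-induction (cg-join g h) =
    P-≅ _ _ (combine≅ true _ _) (P-combine true _ _ (cograph-induction g) (cograph-induction h))
  cograph-induction (cg-iso i g) = P-≅ _ _ i (cograph-induction g)

cograph⇒loopless : ∀ {n} {G : Graph n} → IsCograph G → Loopless G
cograph⇒loopless = cograph-induction Loopless (λ _ → refl) combine-loopless ≅-Transport.loopless

cograph⇒undirected : ∀ {n} {G : Graph n} → IsCograph G → Undirected G
cograph⇒undirected =
  cograph-induction Undirected (λ _ _ → refl) combine-undirected ≅-Transport.undirected

cograph⇒singletonOrTwins : ∀ {n} {G : Graph n} → IsCograph G → SingletonOrTwins G
cograph⇒singletonOrTwins = cograph-induction SingletonOrTwins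
  (inj₁ (zero , λ { zero → refl })) combine-singletonOrTwins ≅-Transport.singletonOrTwins

module _ {n : ℕ} where

  x∈⁅x⁆∪⁅y⁆ : ∀ (x y : Fin n) → x ∈ ⁅ x ⁆ ∪ ⁅ y ⁆
  x∈⁅x⁆∪⁅y⁆ x y = x∈p∪q⁺ (inj₁ (x∈⁅x⁆ x))

  y∈⁅x⁆∪⁅y⁆ : ∀ (x y : Fin n) → y ∈ ⁅ x ⁆ ∪ ⁅ y ⁆
  y∈⁅x⁆∪⁅y⁆ x y = x∈p∪q⁺ (inj₂ (x∈⁅x⁆ y))

  x∈⁅y⁆∪⁅z⁆⇒x≡y⊎x≡z : ∀ {x} (y z : Fin n) → x ∈ ⁅ y ⁆ ∪ ⁅ z ⁆ → x ≡ y ⊎ x ≡ z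
  x∈⁅y⁆∪⁅z⁆⇒x≡y⊎x≡z y z x∈yz with x∈p∪q⁻ ⁅ y ⁆ ⁅ z ⁆ x∈yz
  ... | inj₁ x∈⁅y⁆ = inj₁ (x∈⁅y⁆⇒x≡y y x∈⁅y⁆)
  ... | inj₂ x∈⁅z⁆ = inj₂ (x∈⁅y⁆⇒x≡y z x∈⁅z⁆)

  x∈p⇒⁅x⁆⊆p : ∀ {x} {p : Subset n} → x ∈ p → ⁅ x ⁆ ⊆ p
  x∈p⇒⁅x⁆⊆p {x} {p} x∈p y∈⁅x⁆ = subst (_∈ p) (sym (x∈⁅y⁆⇒x≡y x y∈⁅x⁆)) x∈p

  x∈p⇒0<∣p∣ : ∀ {x} {p : Subset n} → x ∈ p → 0 < ∣ p ∣
  x∈p⇒0<∣p∣ {x} {p} x∈p = subst (_≤ ∣ p ∣) (∣⁅x⁆∣≡1 x) (p⊆q⇒∣p∣≤∣q∣ (x∈p⇒⁅x⁆⊆p x∈p))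

  x≢y∈p⇒1<∣p∣ : ∀ {x y} {p : Subset n} → x ≢ y → x ∈ p → y ∈ p → 1 < ∣ p ∣
  x≢y∈p⇒1<∣p∣ {x} {y} {p} x≢y x∈p y∈p = subst (_< ∣ p ∣) (∣⁅x⁆∣≡1 x)
    (p⊂q⇒∣p∣<∣q∣ (x∈p⇒⁅x⁆⊆p x∈p , y , y∈p , x≢y⇒x∉⁅y⁆ (x≢y ∘ sym)))

  ¬1<∣p∣⇒p⊆⁅x⁆ : ∀ {x} {p : Subset n} → ¬ 1 < ∣ p ∣ → x ∈ p → p ⊆ ⁅ x ⁆
  ¬1<∣p∣⇒p⊆⁅x⁆ {x} ∣p∣≤1 x∈p {y} y∈p with y ≟ x
  ... | yes refl = x∈⁅x⁆ x
  ... | no y≢x  = ⊥-elim (∣p∣≤1 (x≢y∈p⇒1<∣p∣ y≢x y∈p x∈p))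

∣⁅x⁆∪⁅y⁆∣≡2 : ∀ {n} {x y : Fin n} → x ≢ y → ∣ ⁅ x ⁆ ∪ ⁅ y ⁆ ∣ ≡ 2
∣⁅x⁆∪⁅y⁆∣≡2 {x = zero}  {zero}  x≢y = ⊥-elim (x≢y refl)
∣⁅x⁆∪⁅y⁆∣≡2 {x = zero}  {suc y} x≢y =
  cong Nat.suc (trans (cong ∣_∣ (∪-identityˡ ⁅ y ⁆)) (∣⁅x⁆∣≡1 y))
∣⁅x⁆∪⁅y⁆∣≡2 {x = suc x} {zero}  x≢y =
  cong Nat.suc (trans (cong ∣_∣ (∪-identityʳ ⁅ x ⁆)) (∣⁅x⁆∣≡1 x))
∣⁅x⁆∪⁅y⁆∣≡2 {x = suc x} {suc y} x≢y = ∣⁅x⁆∪⁅y⁆∣≡2 (x≢y ∘ cong suc)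

Fort : ∀ {n} → Graph n → Subset n → Set
Fort G T = ∀ {x t} → x ∉ T → t ∈ T → Adj G x t → ∃ λ t′ → t′ ∈ T × t′ ≢ t × Adj G x t′

module _ {n} (G : Graph n) where

  loopless⇒¬Adj-self : Loopless G → ∀ {x} → ¬ Adj G x x
  loopless⇒¬Adj-self loopless {x} x~x with trans (sym (loopless x)) x~x
  ... | ()

  singleton-isolated : ∀ {a} → Loopless G → (∀ x → x ≡ a) → Isolated G a
  singleton-isolated loopless only-a u a~u with only-a u
  ... | refl = loopless⇒¬Adj-self loopless a~u

  ¬isolated⇒neighbour : ∀ {v} → ¬ Isolated G v → ∃ (Adj G v)
  ¬isolated⇒neighbour {v} ¬isolated =
    decidable-stable (any? λ u → G v u Bool.≟ true) λ ∄neighbour →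
      ¬isolated λ u v~u → ∄neighbour (u , v~u)

  fort-unforced : ∀ {T w} → Fort G T → Black G (∁ T) w → w ∉ T
  fort-unforced fort (initial w∈∁T) = x∈∁p⇒x∉p w∈∁T
  fort-unforced fort (force u-black u~w others-black) w∈T
    with t′ , t′∈T , t′≢w , u~t′ ← fort (fort-unforced fort u-black) w∈T u~w
    = fort-unforced fort (others-black t′ u~t′ t′≢w) t′∈T

  fort⇒zeroBlocking : ∀ {T w} → Fort G T → w ∈ T → ZeroBlocking G T
  fort⇒zeroBlocking fort w∈T all-black = fort-unforced fort (all-black _) w∈T

  unreachable-fort : ∀ {v} → (∀ u → ¬ Adj G u v) → Fort G ⁅ v ⁆
  unreachable-fort {v} unreachable {x} _ t∈⁅v⁆ x~t with x∈⁅y⁆⇒x≡y v t∈⁅v⁆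
  ... | refl = ⊥-elim (unreachable x x~t)

  twins-fort : ∀ {u v} → Twins G u v → Fort G (⁅ u ⁆ ∪ ⁅ v ⁆)
  twins-fort {u} {v} (u≢v , same) {x} x∉uv t∈uv x~t =
    [ (λ { refl → v , y∈⁅x⁆∪⁅y⁆ u v , u≢v ∘ sym , trans (sym x-sees-both) x~t })
    , (λ { refl → u , x∈⁅x⁆∪⁅y⁆ u v , u≢v , trans x-sees-both x~t })
    ]′ (x∈⁅y⁆∪⁅z⁆⇒x≡y⊎x≡z u v t∈uv)
    where
    x-sees-both : G x u ≡ G x v
    x-sees-both =
      same x (λ { refl → x∉uv (x∈⁅x⁆∪⁅y⁆ u v) }) (λ { refl → x∉uv (y∈⁅x⁆∪⁅y⁆ u v) })

  zeroBlocking⇒nonempty : ∀ {T} → ZeroBlocking G T → Nonempty T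
  zeroBlocking⇒nonempty {T} blocking = decidable-stable (nonempty? T) λ ¬nonempty →
    blocking λ v → initial (x∉p⇒x∈∁p λ v∈T → ¬nonempty (v , v∈T))

  ⊆⁅w⁆⇒¬zeroBlocking : ∀ {T u w} → T ⊆ ⁅ w ⁆ → Adj G u w → u ≢ w → ¬ ZeroBlocking G T
  ⊆⁅w⁆⇒¬zeroBlocking {T} {u} {w} T⊆⁅w⁆ u~w u≢w blocking = blocking black
    where
    black-if-≢w : ∀ {x} → x ≢ w → Black G (∁ T) x
    black-if-≢w x≢w = initial (x∉p⇒x∈∁p (x≢w ∘ x∈⁅y⁆⇒x≡y w ∘ T⊆⁅w⁆))

    black : ∀ x → Black G (∁ T) x
    black x with x ≟ w
    ... | no x≢w  = black-if-≢w x≢w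
    ... | yes refl = force (black-if-≢w u≢w) u~w (λ y _ y≢w → black-if-≢w y≢w)

  isolated⇒B≡1 : ∀ {v} → Undirected G → Isolated G v → BIs G 1
  isolated⇒B≡1 {v} undirected isolated =
    (⁅ v ⁆ , fort⇒zeroBlocking (unreachable-fort unreachable) (x∈⁅x⁆ v) , ∣⁅x⁆∣≡1 v) ,
    λ T blocking → x∈p⇒0<∣p∣ (proj₂ (zeroBlocking⇒nonempty blocking))
    where
    unreachable : ∀ u → ¬ Adj G u v
    unreachable u u~v = isolated u (trans (undirected v u) u~v)

  module _ (loopless : Loopless G) (undirected : Undirected G)
           (∄isolated : ¬ (∃ λ v → Isolated G v)) where

    zeroBlocking⇒1<∣T∣ : ∀ T → ZeroBlocking G T → 1 < ∣ T ∣
    zeroBlocking⇒1<∣T∣ T blocking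
      with w , w∈T ← zeroBlocking⇒nonempty blocking
      with u , w~u ← ¬isolated⇒neighbour (λ isolated → ∄isolated (w , isolated))
      = decidable-stable (2 ≤? ∣ T ∣) λ ∣T∣≤1 →
          ⊆⁅w⁆⇒¬zeroBlocking (¬1<∣p∣⇒p⊆⁅x⁆ ∣T∣≤1 w∈T) (trans (undirected u w) w~u)
            (λ { refl → loopless⇒¬Adj-self loopless w~u }) blocking

    twins⇒B≡2 : ∀ {u v} → Twins G u v → BIs G 2
    twins⇒B≡2 {u} {v} uv-twins@(u≢v , _) =
      ( ⁅ u ⁆ ∪ ⁅ v ⁆
      , fort⇒zeroBlocking (twins-fort uv-twins) (x∈⁅x⁆∪⁅y⁆ u v)
      , ∣⁅x⁆∪⁅y⁆∣≡2 u≢v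
      ) , zeroBlocking⇒1<∣T∣

corollary1 : ∀ {n} (G : Graph n) → IsCograph G →
    ((∃ λ v → Isolated G v) → BIs G 1) × (¬ (∃ λ v → Isolated G v) → BIs G 2)
corollary1 G cograph = (λ (_ , isolated) → isolated⇒B≡1 G undirected isolated) , no-isolated
  where
  loopless : Loopless G
  loopless = cograph⇒loopless cograph

  undirected : Undirected G
  undirected = cograph⇒undirected cograph

  no-isolated : ¬ (∃ λ v → Isolated G v) → BIs G 2
  no-isolated ∄isolated with cograph⇒singletonOrTwins cograph
  ... | inj₁ (a , only-a)     = ⊥-elim (∄isolated (a , singleton-isolated G loopless only-a))
  ... | inj₂ (u , v , uv-twins) = twins⇒B≡2 G loopless undirected ∄isolated uv-twins
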